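{- Let $m$ be a positive integer and $B$ a Ferrers board. If $B$ fits in $\Delta_{N,m}$ for some $N$ and $B'$ is $m$-weight file equivalent to $B$, then $B'$ fits in $\Delta_{N,m}$.
   Context: A Ferrers board is the set of cells given by weakly increasing column heights, the board being the set of the $b_j$ lowest cells of column $j$ in the quadrant grid; boards are sets of cells, so left zero columns may be added or removed. $\Delta_{N,m}=(0,m,2m,\dots,(N-1)m)$. A board $B$ (written without zero columns) fits in $\Delta_{N,m}$ if, after padding it on the left with zero columns to $N$ columns $(b_0,\dots,b_{N-1})$, we have $b_j\le jm$ for all $0\le j<N$. A file placement on $B$ is a set of cells (rooks) no two in the same column; with $y_i$ rooks in row $i$, $\mathrm{wt}_m F=\prod_i 1\downarrow_{y_i,m}$, where $x\downarrow_{y,m}=x(x-m)\cdots(x-(y-1)m)$, $x\downarrow_{0,m}=1$; $f_{k,m}(B)=\sum_F\mathrm{wt}_m F$ over file placements with $k$ rooks. $B,B'$ are $m$-weight file equivalent if $f_{k,m}(B)=f_{k,m}(B')$ for all $k\ge0$. -}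

module Defs where

open import Data.Nat using (ℕ; zero; suc; _+_; _*_; _∸_; _≤_; _≟_)
open import Data.Integer as ℤ using (ℤ)
open import Data.List using (List; []; _∷_; length; map; filter; concatMap; upTo; foldr; sum)
open import Data.List.Relation.Unary.Linked using (Linked)
open import Data.Maybe using (Maybe; just; nothing)
open import Data.Product using (_×_; _,_)
open import Relation.Nullary.Decidable using (⌊_⌋; ¬?)
open import Data.Bool using (Bool; true; false; if_then_else_)
open import Relation.Binary.PropositionalEquality using (_≡_)

-- A board is given by its list of column heights (b_0, b_1, ...), left to right.  Zero columns are allowed
-- in the list; they contain no cells and do not affect anything below.
IsFerrers : List ℕ → Set
IsFerrers = Linked _≤_

nonzeroCols : List ℕ → List ℕ
nonzeroCols = filter (λ b → ¬? (b ≟ 0))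

private
  boundedFrom : ℕ → ℕ → List ℕ → Set
  boundedFrom m j [] = ⊤'
    where open import Data.Unit using () renaming (⊤ to ⊤')
  boundedFrom m j (b ∷ bs) = (b ≤ j * m) × boundedFrom m (suc j) bs

-- B fits in Δ_{N,m}: written without zero columns and padded on the left with
-- zero columns to exactly N columns (b_0,...,b_{N-1}), we have b_j ≤ j m.
-- (Padded zero columns satisfy the bound trivially, so the real columns occupy
-- positions N - ℓ, ..., N - 1 where ℓ is the number of nonzero columns.)
FitsIn : (N m : ℕ) → List ℕ → Set
FitsIn N m B = (length (nonzeroCols B) ≤ N)
             × boundedFrom m (N ∸ length (nonzeroCols B)) (nonzeroCols B)

fallingM : ℤ → ℕ → ℕ → ℤ
fallingM x zero    m = ℤ.+ 1
fallingM x (suc y) m = fallingM x y m ℤ.* (x ℤ.- ℤ.+ (y * m))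

-- A file placement: for each column, either no rook or the (0-based, from the
-- bottom) row of its rook, which must be < the column height.
filePlacements : List ℕ → List (List (Maybe ℕ))
filePlacements [] = [] ∷ []
filePlacements (b ∷ bs) =
  concatMap (λ c → map (c ∷_) (filePlacements bs)) (nothing ∷ map just (upTo b))

rooks : List (Maybe ℕ) → ℕ
rooks [] = 0
rooks (nothing ∷ p) = rooks p
rooks (just _ ∷ p) = suc (rooks p)

rooksInRow : ℕ → List (Maybe ℕ) → ℕ
rooksInRow i [] = 0
rooksInRow i (nothing ∷ p) = rooksInRow i p
rooksInRow i (just r ∷ p) = if ⌊ r ≟ i ⌋ then suc (rooksInRow i p) else rooksInRow i p

-- maximal column height (all rooks lie in rows < maxHeight)
maxHeight : List ℕ → ℕ
maxHeight = foldr Data.Nat._⊔_ 0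
  where import Data.Nat

weight : ℕ → ℕ → List (Maybe ℕ) → ℤ
weight m h F = foldr (λ i acc → fallingM (ℤ.+ 1) (rooksInRow i F) m ℤ.* acc) (ℤ.+ 1) (upTo h)

fileNumber : ℕ → ℕ → List ℕ → ℤ
fileNumber k m B =
  foldr ℤ._+_ (ℤ.+ 0)
    (map (weight m (maxHeight B))
      (filter (λ F → rooks F ≟ k) (filePlacements B)))

FileEquiv : ℕ → List ℕ → List ℕ → Set
FileEquiv m B B' = (k : ℕ) → fileNumber k m B ≡ fileNumber k m B'

-- Padding a Ferrers board B with zero columns to length L, the factorization theorem gives
-- ∑ₖ f_{k,m}(B) x↓_{L-k,m} = ∏_{j<L} (x - (j m - bⱼ)), so m-weight file equivalent boards have the same
-- multiset of roots j m - bⱼ, integer polynomials splitting uniquely into linear factors.  With T = L - N,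
-- the T roots at positions j < T lie below T m for every board, and a board fits in Δ_{N,m} exactly when
-- no other root does, i.e. when exactly T of its roots lie below T m.

module Submission where

open import Defs
open import Data.Nat using (ℕ; NonZero)
open import Data.List using (List)

open import Algebra.Core using (Op₂)
open import Algebra.Structures using (IsCommutativeMonoid)
open import Data.Bool using (true; false; if_then_else_)
open import Data.Integer as ℤ using (ℤ; +_; 0ℤ; 1ℤ; _+_; _*_; _-_; -_; _⊖_; ∣_∣)
import Data.Integer.Properties as ℤ
open import Data.Integer.Tactic.RingSolver using (solve-∀)
open import Data.List using ([]; _∷_; _++_; _∷ʳ_; [_]; map; concatMap; filter; upTo; length; replicate)
open import Data.List.Membership.Propositional using (_∈_)
open import Data.List.Membership.Propositional.Properties using (∈-upTo⁺; ∈-upTo⁻; ∈-∃++)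
open import Data.List.Properties
  using (length-upTo; length-++; length-replicate; foldr-map; ++-assoc;
         filter-all; filter-none; filter-some; filter-accept; filter-++)
open import Data.List.Relation.Binary.Permutation.Propositional using (_↭_; ↭-refl; ↭-prep; ↭-sym; ↭-trans)
open import Data.List.Relation.Binary.Permutation.Propositional.Properties using (shift; filter-↭; ↭-length)
open import Data.List.Relation.Binary.Pointwise using (Pointwise; []; _∷_; Pointwise-length)
open import Data.List.Relation.Unary.All as All using (All; []; _∷_)
import Data.List.Relation.Unary.All.Properties as All
open import Data.List.Relation.Unary.AllPairs using ([]; _∷_)
open import Data.List.Relation.Unary.Any using (here; there)
open import Data.List.Relation.Unary.Linked as Linked using (Linked; []; [-]; _∷_)
open import Data.List.Relation.Unary.Linked.Properties as Linked using (Linked⇒All)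
open import Data.List.Relation.Unary.Unique.Propositional using (Unique)
open import Data.List.Relation.Unary.Unique.Propositional.Properties using (upTo⁺)
open import Data.List.Reverse using (Reverse; []; _∶_∶ʳ_; reverseView)
open import Data.Maybe using (Maybe; just; nothing)
import Data.Maybe.Relation.Unary.All as Maybe
open import Data.Nat as ℕ using (zero; suc; _≤_; _<_; _≟_; _∸_; s≤s; z≤n)
import Data.Nat.Properties as ℕ
open import Data.Product using (_×_; _,_; ∃-syntax; proj₁; proj₂)
open import Data.Sum using (inj₁; inj₂)
open import Data.Unit using (⊤; tt)
open import Function using (id; _∘_)
open import Function.Bundles using (_⇔_; mk⇔; Equivalence)
open import Function.Properties.Equivalence using (⇔-setoid) renaming (sym to ⇔-sym; trans to ⇔-trans)
open import Level using (Level)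
open import Relation.Binary.PropositionalEquality hiding ([_])
import Relation.Binary.Reasoning.Setoid
open import Relation.Nullary using (does; ¬_; ¬?; yes; no; contradiction)
open import Relation.Nullary.Decidable using (dec-true; dec-false)
open import Relation.Unary using (Pred; Decidable)

module ⇔-Reasoning = Relation.Binary.Reasoning.Setoid (⇔-setoid Level.zero)

module BigOperator (_∙_ : Op₂ ℤ) (ε : ℤ) (isCM : IsCommutativeMonoid _≡_ _∙_ ε) where

  open IsCommutativeMonoid isCM using (assoc; comm; identityˡ)
  open ≡-Reasoning

  fold : {A : Set} → List A → (A → ℤ) → ℤ
  fold xs f = Data.List.foldr (λ x r → f x ∙ r) ε xs

  fold-cong : {A : Set} (xs : List A) {f g : A → ℤ} →
              (∀ x → x ∈ xs → f x ≡ g x) → fold xs f ≡ fold xs g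
  fold-cong []       f≡g = refl
  fold-cong (x ∷ xs) f≡g = cong₂ _∙_ (f≡g x (here refl)) (fold-cong xs (λ y y∈ → f≡g y (there y∈)))

  fold-++ : {A : Set} (xs ys : List A) (f : A → ℤ) → fold (xs ++ ys) f ≡ fold xs f ∙ fold ys f
  fold-++ []       ys f = sym (identityˡ _)
  fold-++ (x ∷ xs) ys f = trans (cong (f x ∙_) (fold-++ xs ys f)) (sym (assoc _ _ _))

  fold-map : {A B : Set} (g : A → B) (xs : List A) (f : B → ℤ) →
             fold (map g xs) f ≡ fold xs (λ x → f (g x))
  fold-map g []       f = refl
  fold-map g (x ∷ xs) f = cong (f (g x) ∙_) (fold-map g xs f)

  fold-concatMap : {A B : Set} (g : A → List B) (xs : List A) (f : B → ℤ) →
                   fold (concatMap g xs) f ≡ fold xs (λ x → fold (g x) f)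
  fold-concatMap g []       f = refl
  fold-concatMap g (x ∷ xs) f =
    trans (fold-++ (g x) (concatMap g xs) f) (cong (fold (g x) f ∙_) (fold-concatMap g xs f))

  fold-ε : {A : Set} (xs : List A) → fold xs (λ _ → ε) ≡ ε
  fold-ε []       = refl
  fold-ε (x ∷ xs) = trans (identityˡ _) (fold-ε xs)

  fold-∙ : {A : Set} (xs : List A) (f g : A → ℤ) → fold xs (λ x → f x ∙ g x) ≡ fold xs f ∙ fold xs g
  fold-∙ []       f g = sym (identityˡ ε)
  fold-∙ (x ∷ xs) f g = begin
    (f x ∙ g x) ∙ fold xs (λ y → f y ∙ g y) ≡⟨ cong ((f x ∙ g x) ∙_) (fold-∙ xs f g) ⟩
    (f x ∙ g x) ∙ (fold xs f ∙ fold xs g)   ≡⟨ middleFour ⟩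
    (f x ∙ fold xs f) ∙ (g x ∙ fold xs g)   ∎
    where
    middleFour : ∀ {a b c d} → (a ∙ b) ∙ (c ∙ d) ≡ (a ∙ c) ∙ (b ∙ d)
    middleFour {a} {b} {c} {d} = begin
      (a ∙ b) ∙ (c ∙ d) ≡⟨ assoc a b (c ∙ d) ⟩
      a ∙ (b ∙ (c ∙ d)) ≡⟨ cong (a ∙_) (sym (assoc b c d)) ⟩
      a ∙ ((b ∙ c) ∙ d) ≡⟨ cong (λ t → a ∙ (t ∙ d)) (comm b c) ⟩
      a ∙ ((c ∙ b) ∙ d) ≡⟨ cong (a ∙_) (assoc c b d) ⟩
      a ∙ (c ∙ (b ∙ d)) ≡⟨ sym (assoc a c (b ∙ d)) ⟩
      (a ∙ c) ∙ (b ∙ d) ∎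

  fold-comm : {A B : Set} (xs : List A) (ys : List B) (f : A → B → ℤ) →
              fold xs (λ x → fold ys (f x)) ≡ fold ys (λ y → fold xs (λ x → f x y))
  fold-comm []       ys f = sym (fold-ε ys)
  fold-comm (x ∷ xs) ys f =
    trans (cong (fold ys (f x) ∙_) (fold-comm xs ys f)) (sym (fold-∙ ys (f x) (λ y → fold xs (λ x → f x y))))

  fold-filter : {A : Set} {p : Level} {P : Pred A p} (P? : Decidable P) (xs : List A) (f : A → ℤ) →
                fold (filter P? xs) f ≡ fold xs (λ x → if does (P? x) then f x else ε)
  fold-filter P? []       f = refl
  fold-filter P? (x ∷ xs) f with does (P? x)
  ... | true  = cong (f x ∙_) (fold-filter P? xs f)
  ... | false = trans (fold-filter P? xs f) (sym (identityˡ _))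

  fold-update : {A : Set} {xs : List A} {r : A} (f g : A → ℤ) (c : ℤ) → Unique xs → r ∈ xs →
                f r ≡ g r ∙ c → (∀ x → x ≢ r → f x ≡ g x) → fold xs f ≡ fold xs g ∙ c
  fold-update {xs = x ∷ xs} f g c (x∉ ∷ _) (here refl) fr others = begin
    f x ∙ fold xs f       ≡⟨ cong₂ _∙_ fr (fold-cong xs λ y y∈ → others y λ { refl → All.lookup x∉ y∈ refl }) ⟩
    (g x ∙ c) ∙ fold xs g ≡⟨ assoc _ _ _ ⟩
    g x ∙ (c ∙ fold xs g) ≡⟨ cong (g x ∙_) (comm c _) ⟩
    g x ∙ (fold xs g ∙ c) ≡⟨ sym (assoc _ _ _) ⟩
    (g x ∙ fold xs g) ∙ c ∎
  fold-update {xs = x ∷ xs} f g c (x∉ ∷ u) (there r∈) fr others = begin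
    f x ∙ fold xs f
      ≡⟨ cong₂ _∙_ (others x λ { refl → All.lookup x∉ r∈ refl }) (fold-update f g c u r∈ fr others) ⟩
    g x ∙ (fold xs g ∙ c) ≡⟨ sym (assoc _ _ _) ⟩
    (g x ∙ fold xs g) ∙ c ∎

  fold-single : {A : Set} {xs : List A} {r : A} (f : A → ℤ) → Unique xs → r ∈ xs →
                (∀ x → x ≢ r → f x ≡ ε) → fold xs f ≡ f r
  fold-single {xs = xs} {r} f u r∈ others = begin
    fold xs f            ≡⟨ fold-update f (λ _ → ε) (f r) u r∈ (sym (identityˡ (f r))) others ⟩
    fold xs (λ _ → ε) ∙ f r ≡⟨ cong (_∙ f r) (fold-ε xs) ⟩
    ε ∙ f r              ≡⟨ identityˡ (f r) ⟩
    f r                  ∎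

module Sum = BigOperator _+_ 0ℤ ℤ.+-0-isCommutativeMonoid
module Product = BigOperator _*_ 1ℤ ℤ.*-1-isCommutativeMonoid

∑ : {A : Set} → List A → (A → ℤ) → ℤ
∑ = Sum.fold

∏ : {A : Set} → List A → (A → ℤ) → ℤ
∏ = Product.fold

∑-*ʳ : {A : Set} (xs : List A) (f : A → ℤ) (c : ℤ) → ∑ xs (λ x → f x * c) ≡ ∑ xs f * c
∑-*ʳ []       f c = sym (ℤ.*-zeroˡ c)
∑-*ʳ (x ∷ xs) f c = trans (cong (_+_ (f x * c)) (∑-*ʳ xs f c)) (sym (ℤ.*-distribʳ-+ c (f x) (∑ xs f)))

choices : ℕ → List (Maybe ℕ)
choices b = nothing ∷ map just (upTo b)

PlacementOn : List ℕ → List (Maybe ℕ) → Set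
PlacementOn = Pointwise (λ b → Maybe.All (_< b))

RowsBelow : ℕ → List (Maybe ℕ) → Set
RowsBelow h = All (Maybe.All (_< h))

filePlacements-on : (B : List ℕ) → All (PlacementOn B) (filePlacements B)
filePlacements-on []      = [] ∷ []
filePlacements-on (b ∷ B) =
  All.concat⁺ (All.map⁺ (placed Maybe.nothing ∷
                         All.map⁺ (All.applyUpTo⁺₁ id b (λ i<b → placed (Maybe.just i<b)))))
  where
  placed : ∀ {c} → Maybe.All (_< b) c → All (PlacementOn (b ∷ B)) (map (c ∷_) (filePlacements B))
  placed c<b = All.map⁺ (All.map (c<b ∷_) (filePlacements-on B))

placementOn⇒rowsBelow : ∀ {h B F} → All (_≤ h) B → PlacementOn B F → RowsBelow h F
placementOn⇒rowsBelow []           []                   = []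
placementOn⇒rowsBelow (b≤h ∷ B≤h) (Maybe.nothing ∷ F)  = Maybe.nothing ∷ placementOn⇒rowsBelow B≤h F
placementOn⇒rowsBelow (b≤h ∷ B≤h) (Maybe.just r<b ∷ F) =
  Maybe.just (ℕ.<-≤-trans r<b b≤h) ∷ placementOn⇒rowsBelow B≤h F

rooks≤length : (F : List (Maybe ℕ)) → rooks F ≤ length F
rooks≤length []            = z≤n
rooks≤length (nothing ∷ F) = ℕ.m≤n⇒m≤1+n (rooks≤length F)
rooks≤length (just _ ∷ F)  = s≤s (rooks≤length F)

rooks≤columns : ∀ {B F} → PlacementOn B F → rooks F ≤ length B
rooks≤columns {F = F} BF = ℕ.≤-trans (rooks≤length F) (ℕ.≤-reflexive (sym (Pointwise-length BF)))

rooks-++ : (F G : List (Maybe ℕ)) → rooks (F ++ G) ≡ rooks F ℕ.+ rooks G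
rooks-++ []            G = refl
rooks-++ (nothing ∷ F) G = rooks-++ F G
rooks-++ (just _ ∷ F)  G = cong suc (rooks-++ F G)

rooksInRow-just-≡ : ∀ r F → rooksInRow r (just r ∷ F) ≡ suc (rooksInRow r F)
rooksInRow-just-≡ r F with r ≟ r
... | yes _   = refl
... | no r≢r = contradiction refl r≢r

rooksInRow-just-≢ : ∀ {r i} F → i ≢ r → rooksInRow i (just r ∷ F) ≡ rooksInRow i F
rooksInRow-just-≢ {r} {i} F i≢r with r ≟ i
... | yes r≡i = contradiction (sym r≡i) i≢r
... | no _    = refl

rooksInRow-++ : ∀ i (F G : List (Maybe ℕ)) → rooksInRow i (F ++ G) ≡ rooksInRow i F ℕ.+ rooksInRow i G
rooksInRow-++ i []            G = refl
rooksInRow-++ i (nothing ∷ F) G = rooksInRow-++ i F G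
rooksInRow-++ i (just r ∷ F)  G with r ≟ i
... | yes _ = cong suc (rooksInRow-++ i F G)
... | no _  = rooksInRow-++ i F G

rooks-∷ʳ : ∀ F c → rooks (F ∷ʳ c) ≡ rooks (c ∷ F)
rooks-∷ʳ F c = trans (rooks-++ F [ c ]) (trans (ℕ.+-comm (rooks F) _) (sym (rooks-++ [ c ] F)))

weight-∷ʳ : ∀ m h F c → weight m h (F ∷ʳ c) ≡ weight m h (c ∷ F)
weight-∷ʳ m h F c = Product.fold-cong (upTo h) λ i _ → cong (λ y → fallingM 1ℤ y m) (rowsSwap i)
  where
  rowsSwap : ∀ i → rooksInRow i (F ∷ʳ c) ≡ rooksInRow i (c ∷ F)
  rowsSwap i = trans (rooksInRow-++ i F [ c ])
                     (trans (ℕ.+-comm (rooksInRow i F) _) (sym (rooksInRow-++ i [ c ] F)))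

weight-just : ∀ m {h r} F → r < h → weight m h (just r ∷ F) ≡ weight m h F * (1ℤ - + (rooksInRow r F ℕ.* m))
weight-just m {h} {r} F r<h =
  Product.fold-update _ _ _ (upTo⁺ h) (∈-upTo⁺ r<h)
    (cong (λ y → fallingM 1ℤ y m) (rooksInRow-just-≡ r F))
    (λ i i≢r → cong (λ y → fallingM 1ℤ y m) (rooksInRow-just-≢ F i≢r))

∑-rooksInRow : ∀ {h} F → RowsBelow h F → ∑ (upTo h) (λ i → + rooksInRow i F) ≡ + rooks F
∑-rooksInRow {h} []            []                       = Sum.fold-ε (upTo h)
∑-rooksInRow {h} (nothing ∷ F) (_ ∷ below)              = ∑-rooksInRow F below
∑-rooksInRow {h} (just r ∷ F)  (Maybe.just r<h ∷ below) = begin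
  ∑ (upTo h) (λ i → + rooksInRow i (just r ∷ F))
    ≡⟨ Sum.fold-update _ _ 1ℤ (upTo⁺ h) (∈-upTo⁺ r<h) newRow oldRows ⟩
  ∑ (upTo h) (λ i → + rooksInRow i F) + 1ℤ
    ≡⟨ cong (_+ 1ℤ) (∑-rooksInRow F below) ⟩
  + rooks F + 1ℤ
    ≡⟨ ℤ.+-comm (+ rooks F) 1ℤ ⟩
  + suc (rooks F) ∎
  where
  open ≡-Reasoning
  newRow : + rooksInRow r (just r ∷ F) ≡ + rooksInRow r F + 1ℤ
  newRow = trans (cong +_ (rooksInRow-just-≡ r F)) (ℤ.+-comm 1ℤ (+ rooksInRow r F))
  oldRows : ∀ i → i ≢ r → + rooksInRow i (just r ∷ F) ≡ + rooksInRow i F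
  oldRows i i≢r = cong +_ (rooksInRow-just-≢ F i≢r)

∑-filePlacements-∷ʳ : ∀ A b (g : List (Maybe ℕ) → ℤ) →
  ∑ (filePlacements (A ∷ʳ b)) g ≡ ∑ (filePlacements A) (λ F → ∑ (choices b) (λ c → g (F ∷ʳ c)))
∑-filePlacements-∷ʳ [] b g = begin
  ∑ (concatMap (λ c → [ c ] ∷ []) (choices b)) g
    ≡⟨ Sum.fold-concatMap (λ c → [ c ] ∷ []) (choices b) g ⟩
  ∑ (choices b) (λ c → g [ c ] + 0ℤ)
    ≡⟨ sym (ℤ.+-identityʳ _) ⟩
  ∑ (choices b) (λ c → g [ c ] + 0ℤ) + 0ℤ
    ≡⟨ cong (_+ 0ℤ) (Sum.fold-cong (choices b) λ c _ → ℤ.+-identityʳ (g [ c ])) ⟩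
  ∑ (choices b) (λ c → g [ c ]) + 0ℤ ∎
  where open ≡-Reasoning
∑-filePlacements-∷ʳ (a ∷ A) b g = begin
  ∑ (concatMap (λ c → map (c ∷_) (filePlacements (A ∷ʳ b))) (choices a)) g
    ≡⟨ Sum.fold-concatMap (λ c → map (c ∷_) (filePlacements (A ∷ʳ b))) (choices a) g ⟩
  ∑ (choices a) (λ c → ∑ (map (c ∷_) (filePlacements (A ∷ʳ b))) g)
    ≡⟨ Sum.fold-cong (choices a) (λ c _ → trans (Sum.fold-map (c ∷_) (filePlacements (A ∷ʳ b)) g)
                                               (∑-filePlacements-∷ʳ A b (g ∘ (c ∷_)))) ⟩
  ∑ (choices a) (λ c → ∑ (filePlacements A) (λ F → G (c ∷ F)))
    ≡⟨ Sum.fold-cong (choices a) (λ c _ → sym (Sum.fold-map (c ∷_) (filePlacements A) G)) ⟩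
  ∑ (choices a) (λ c → ∑ (map (c ∷_) (filePlacements A)) G)
    ≡⟨ sym (Sum.fold-concatMap (λ c → map (c ∷_) (filePlacements A)) (choices a) G) ⟩
  ∑ (filePlacements (a ∷ A)) G ∎
  where
  open ≡-Reasoning
  G : List (Maybe ℕ) → ℤ
  G F = ∑ (choices b) (λ c → g (F ∷ʳ c))

-- The factorization theorem

∑-affine : {A : Set} (xs : List A) (a : A → ℤ) (c d : ℤ) →
           ∑ xs (λ i → c * (1ℤ - a i * d)) ≡ c * (+ length xs - ∑ xs a * d)
∑-affine []       a c d = empty c d
  where
  empty : ∀ c d → 0ℤ ≡ c * (0ℤ - 0ℤ * d)
  empty = solve-∀
∑-affine (i ∷ xs) a c d =
  trans (cong (_+_ (c * (1ℤ - a i * d))) (∑-affine xs a c d)) (step c d (a i) (+ length xs) (∑ xs a))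
  where
  step : ∀ c d ai l s → c * (1ℤ - ai * d) + c * (l - s * d) ≡ c * ((1ℤ + l) - (ai + s) * d)
  step = solve-∀

pos-[∸]* : ∀ {s L m} → s ≤ L → + ((L ∸ s) ℕ.* m) ≡ + (L ℕ.* m) - + s * + m
pos-[∸]* {s} {L} {m} s≤L = begin
  + ((L ∸ s) ℕ.* m)          ≡⟨ cong +_ (ℕ.*-distribʳ-∸ m L s) ⟩
  + (L ℕ.* m ∸ s ℕ.* m)      ≡⟨ sym (ℤ.⊖-≥ (ℕ.*-monoˡ-≤ m s≤L)) ⟩
  L ℕ.* m ⊖ s ℕ.* m          ≡⟨ sym (ℤ.m-n≡m⊖n (L ℕ.* m) (s ℕ.* m)) ⟩
  + (L ℕ.* m) - + (s ℕ.* m)  ≡⟨ cong (_-_ (+ (L ℕ.* m))) (ℤ.pos-* s m) ⟩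
  + (L ℕ.* m) - + s * + m    ∎
  where open ≡-Reasoning

placementSum : (m H L : ℕ) → ℤ → List ℕ → ℤ
placementSum m H L x B = ∑ (filePlacements B) (λ F → weight m H F * fallingM x (L ∸ rooks F) m)

-- The new column either stays empty, adding the factor x - (L - s) m to the falling factorial, or gets a
-- rook in one of its b rows, multiplying the weight by 1 - yᵢ m; these sum to b - s m over the rows.
column-step : ∀ m {H L b} x F → b ≤ H → RowsBelow b F → rooks F ≤ L →
  ∑ (choices b) (λ c → weight m H (F ∷ʳ c) * fallingM x (suc L ∸ rooks (F ∷ʳ c)) m)
  ≡ weight m H F * fallingM x (L ∸ rooks F) m * (x - (+ (L ℕ.* m) - + b))
column-step m {H} {L} {b} x F b≤H below s≤L = begin
  g nothing + ∑ (map just (upTo b)) g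
    ≡⟨ cong (_+_ (g nothing)) (Sum.fold-map just (upTo b) g) ⟩
  g nothing + ∑ (upTo b) (g ∘ just)
    ≡⟨ cong₂ _+_ noRook (Sum.fold-cong (upTo b) rookInRow) ⟩
  w * (f * (x - + ((L ∸ s) ℕ.* m))) + ∑ (upTo b) (λ i → (w * f) * (1ℤ - + rooksInRow i F * + m))
    ≡⟨ cong (_+_ (w * (f * (x - + ((L ∸ s) ℕ.* m)))))
            (∑-affine (upTo b) (λ i → + rooksInRow i F) (w * f) (+ m)) ⟩
  w * (f * (x - + ((L ∸ s) ℕ.* m))) + (w * f) * (+ length (upTo b) - ∑ (upTo b) (λ i → + rooksInRow i F) * + m)
    ≡⟨ cong₂ (λ l r → w * (f * (x - + ((L ∸ s) ℕ.* m))) + (w * f) * (+ l - r * + m))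
             (length-upTo b) (∑-rooksInRow F below) ⟩
  w * (f * (x - + ((L ∸ s) ℕ.* m))) + (w * f) * (+ b - + s * + m)
    ≡⟨ cong (λ t → w * (f * (x - t)) + (w * f) * (+ b - + s * + m)) (pos-[∸]* s≤L) ⟩
  w * (f * (x - (+ (L ℕ.* m) - + s * + m))) + (w * f) * (+ b - + s * + m)
    ≡⟨ collect w f x (+ (L ℕ.* m)) (+ s * + m) (+ b) ⟩
  w * f * (x - (+ (L ℕ.* m) - + b)) ∎
  where
  open ≡-Reasoning
  s = rooks F
  w = weight m H F
  f = fallingM x (L ∸ s) m
  g : Maybe ℕ → ℤ
  g c = weight m H (F ∷ʳ c) * fallingM x (suc L ∸ rooks (F ∷ʳ c)) m
  noRook : g nothing ≡ w * (f * (x - + ((L ∸ s) ℕ.* m)))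
  noRook rewrite weight-∷ʳ m H F nothing | rooks-∷ʳ F nothing | ℕ.+-∸-assoc 1 s≤L = refl
  rookInRow : ∀ i → i ∈ upTo b → g (just i) ≡ (w * f) * (1ℤ - + rooksInRow i F * + m)
  rookInRow i i∈ rewrite weight-∷ʳ m H F (just i) | rooks-∷ʳ F (just i)
                       | weight-just m F (ℕ.<-≤-trans (∈-upTo⁻ i∈) b≤H)
                       | ℤ.pos-* (rooksInRow i F) m = swapMiddle w _ f
    where
    swapMiddle : ∀ a b c → a * b * c ≡ a * c * b
    swapMiddle = solve-∀
  collect : ∀ w f x l a b → w * (f * (x - (l - a))) + (w * f) * (b - a) ≡ w * f * (x - (l - b))
  collect = solve-∀

placementSum-∷ʳ : ∀ m {H} x A b → b ≤ H → All (_≤ b) A →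
  placementSum m H (suc (length A)) x (A ∷ʳ b) ≡ placementSum m H (length A) x A * (x - (+ (length A ℕ.* m) - + b))
placementSum-∷ʳ m {H} x A b b≤H A≤b = begin
  placementSum m H (suc (length A)) x (A ∷ʳ b)
    ≡⟨ ∑-filePlacements-∷ʳ A b (term (suc (length A))) ⟩
  ∑ (filePlacements A) (λ F → ∑ (choices b) (λ c → term (suc (length A)) (F ∷ʳ c)))
    ≡⟨ Sum.fold-cong (filePlacements A) (λ F F∈ → let on = All.lookup (filePlacements-on A) F∈ in
         column-step m x F b≤H (placementOn⇒rowsBelow A≤b on) (rooks≤columns on)) ⟩
  ∑ (filePlacements A) (λ F → term (length A) F * (x - (+ (length A ℕ.* m) - + b)))
    ≡⟨ ∑-*ʳ (filePlacements A) (term (length A)) (x - (+ (length A ℕ.* m) - + b)) ⟩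
  placementSum m H (length A) x A * (x - (+ (length A ℕ.* m) - + b)) ∎
  where
  open ≡-Reasoning
  term : ℕ → List (Maybe ℕ) → ℤ
  term L F = weight m H F * fallingM x (L ∸ rooks F) m

roots : ℕ → ℕ → List ℕ → List ℤ
roots m j []       = []
roots m j (b ∷ bs) = (+ (j ℕ.* m) - + b) ∷ roots m (suc j) bs

roots-++ : ∀ m j xs ys → roots m j (xs ++ ys) ≡ roots m j xs ++ roots m (j ℕ.+ length xs) ys
roots-++ m j []       ys = cong (λ k → roots m k ys) (sym (ℕ.+-identityʳ j))
roots-++ m j (x ∷ xs) ys =
  cong (_ ∷_) (trans (roots-++ m (suc j) xs ys)
                     (cong (λ k → roots m (suc j) xs ++ roots m k ys) (sym (ℕ.+-suc j (length xs)))))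

rootProduct : ℤ → List ℤ → ℤ
rootProduct x rs = ∏ rs (_-_ x)

rootProduct-∷ʳ : ∀ x rs r → rootProduct x (rs ∷ʳ r) ≡ rootProduct x rs * (x - r)
rootProduct-∷ʳ x rs r = trans (Product.fold-++ rs [ r ] (_-_ x)) (cong (rootProduct x rs *_) (ℤ.*-identityʳ (x - r)))

length-∷ʳ : ∀ (A : List ℕ) b → length (A ∷ʳ b) ≡ suc (length A)
length-∷ʳ A b = trans (length-++ A) (ℕ.+-comm (length A) 1)

linked-∷ʳ⁻ : ∀ A {b} → Linked _≤_ (A ∷ʳ b) → Linked _≤_ A × All (_≤ b) A
linked-∷ʳ⁻ []           _           = [] , []
linked-∷ʳ⁻ (a ∷ [])     (a≤b ∷ _)   = [-] , a≤b ∷ []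
linked-∷ʳ⁻ (a ∷ a′ ∷ A) (a≤a′ ∷ l) with linked-∷ʳ⁻ (a′ ∷ A) l
... | l′ , a′≤b ∷ A≤b = a≤a′ ∷ l′ , ℕ.≤-trans a≤a′ a′≤b ∷ a′≤b ∷ A≤b

factorization : ∀ m {H} x P → Linked _≤_ P → All (_≤ H) P →
  placementSum m H (length P) x P ≡ rootProduct x (roots m 0 P)
factorization m {H} x P = go P (reverseView P)
  where
  go : ∀ P → Reverse P → Linked _≤_ P → All (_≤ H) P →
       placementSum m H (length P) x P ≡ rootProduct x (roots m 0 P)
  go .[] [] _ _ = trans (ℤ.+-identityʳ _) (trans (ℤ.*-identityʳ _) (Product.fold-ε (upTo H)))
  go .(A ∷ʳ b) (A ∶ rev ∶ʳ b) linked bounded with linked-∷ʳ⁻ A linked | All.∷ʳ⁻ bounded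
  ... | linkedA , A≤b | A≤H , b≤H = begin
    placementSum m H (length (A ∷ʳ b)) x (A ∷ʳ b)
      ≡⟨ cong (λ L → placementSum m H L x (A ∷ʳ b)) (length-∷ʳ A b) ⟩
    placementSum m H (suc (length A)) x (A ∷ʳ b)
      ≡⟨ placementSum-∷ʳ m x A b b≤H A≤b ⟩
    placementSum m H (length A) x A * (x - r)
      ≡⟨ cong (_* (x - r)) (go A rev linkedA A≤H) ⟩
    rootProduct x (roots m 0 A) * (x - r)
      ≡⟨ sym (rootProduct-∷ʳ x (roots m 0 A) r) ⟩
    rootProduct x (roots m 0 A ∷ʳ r)
      ≡⟨ cong (rootProduct x) (sym (roots-++ m 0 A [ b ])) ⟩
    rootProduct x (roots m 0 (A ∷ʳ b)) ∎
    where
    open ≡-Reasoning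
    r = + (length A ℕ.* m) - + b

fileNumber≡∑ : ∀ k m B → fileNumber k m B ≡
  ∑ (filePlacements B) (λ F → if does (rooks F ≟ k) then weight m (maxHeight B) F else 0ℤ)
fileNumber≡∑ k m B =
  trans (foldr-map _+_ (weight m (maxHeight B)) 0ℤ (filter (λ F → rooks F ≟ k) (filePlacements B)))
        (Sum.fold-filter (λ F → rooks F ≟ k) (filePlacements B) (weight m (maxHeight B)))

placementSum≡∑fileNumber : ∀ m {L} x P → length P ≤ L →
  placementSum m (maxHeight P) L x P ≡ ∑ (upTo (suc L)) (λ k → fileNumber k m P * fallingM x (L ∸ k) m)
placementSum≡∑fileNumber m {L} x P P≤L = sym (begin
  ∑ (upTo (suc L)) (λ k → fileNumber k m P * φ k)
    ≡⟨ Sum.fold-cong (upTo (suc L)) (λ k _ → cong (_* φ k) (fileNumber≡∑ k m P)) ⟩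
  ∑ (upTo (suc L)) (λ k → ∑ (filePlacements P) (λ F → δ F k) * φ k)
    ≡⟨ Sum.fold-cong (upTo (suc L)) (λ k _ → sym (∑-*ʳ (filePlacements P) (λ F → δ F k) (φ k))) ⟩
  ∑ (upTo (suc L)) (λ k → ∑ (filePlacements P) (λ F → δ F k * φ k))
    ≡⟨ Sum.fold-comm (upTo (suc L)) (filePlacements P) (λ k F → δ F k * φ k) ⟩
  ∑ (filePlacements P) (λ F → ∑ (upTo (suc L)) (λ k → δ F k * φ k))
    ≡⟨ Sum.fold-cong (filePlacements P) (λ F F∈ → trans
         (Sum.fold-single (λ k → δ F k * φ k) (upTo⁺ (suc L)) (∈-upTo⁺ (s≤s (rooks≤L F∈))) (offRooks F))
         (atRooks F)) ⟩
  placementSum m (maxHeight P) L x P ∎)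
  where
  open ≡-Reasoning
  φ : ℕ → ℤ
  φ k = fallingM x (L ∸ k) m
  δ : List (Maybe ℕ) → ℕ → ℤ
  δ F k = if does (rooks F ≟ k) then weight m (maxHeight P) F else 0ℤ
  rooks≤L : ∀ {F} → F ∈ filePlacements P → rooks F ≤ L
  rooks≤L F∈ = ℕ.≤-trans (rooks≤columns (All.lookup (filePlacements-on P) F∈)) P≤L
  offRooks : ∀ F k → k ≢ rooks F → δ F k * φ k ≡ 0ℤ
  offRooks F k k≢r = trans
    (cong (λ b → (if b then weight m (maxHeight P) F else 0ℤ) * φ k) (dec-false (rooks F ≟ k) (k≢r ∘ sym)))
    (ℤ.*-zeroˡ (φ k))
  atRooks : ∀ F → δ F (rooks F) * φ (rooks F) ≡ weight m (maxHeight P) F * φ (rooks F)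
  atRooks F =
    cong (λ b → (if b then weight m (maxHeight P) F else 0ℤ) * φ (rooks F)) (dec-true (rooks F ≟ rooks F) refl)

fileNumber-0∷ : ∀ k m B → fileNumber k m (0 ∷ B) ≡ fileNumber k m B
fileNumber-0∷ k m B = begin
  fileNumber k m (0 ∷ B)
    ≡⟨ fileNumber≡∑ k m (0 ∷ B) ⟩
  ∑ (concatMap (λ c → map (c ∷_) (filePlacements B)) (nothing ∷ [])) δ
    ≡⟨ Sum.fold-concatMap (λ c → map (c ∷_) (filePlacements B)) (nothing ∷ []) δ ⟩
  ∑ (map (nothing ∷_) (filePlacements B)) δ + 0ℤ
    ≡⟨ ℤ.+-identityʳ _ ⟩
  ∑ (map (nothing ∷_) (filePlacements B)) δ
    ≡⟨ Sum.fold-map (nothing ∷_) (filePlacements B) δ ⟩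
  ∑ (filePlacements B) δ
    ≡⟨ sym (fileNumber≡∑ k m B) ⟩
  fileNumber k m B ∎
  where
  open ≡-Reasoning
  δ : List (Maybe ℕ) → ℤ
  δ F = if does (rooks F ≟ k) then weight m (maxHeight B) F else 0ℤ

fileNumber-zeros : ∀ k m z B → fileNumber k m (replicate z 0 ++ B) ≡ fileNumber k m B
fileNumber-zeros k m zero    B = refl
fileNumber-zeros k m (suc z) B = trans (fileNumber-0∷ k m (replicate z 0 ++ B)) (fileNumber-zeros k m z B)

ferrers-zeros++nonzeroCols : ∀ B → IsFerrers B → ∃[ z ] B ≡ replicate z 0 ++ nonzeroCols B
ferrers-zeros++nonzeroCols []          _      = 0 , refl
ferrers-zeros++nonzeroCols (zero ∷ B)  ferrers with z , eq ← ferrers-zeros++nonzeroCols B (Linked.tail ferrers) =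
  suc z , cong (0 ∷_) eq
ferrers-zeros++nonzeroCols (suc b ∷ B) ferrers =
  0 , sym (filter-all (λ c → ¬? (c ≟ 0)) (All.map positive (Linked⇒All ℕ.≤-trans ℕ.≤-refl ferrers)))
  where
  positive : ∀ {c} → suc b ≤ c → c ≢ 0
  positive 1+b≤c refl = contradiction 1+b≤c λ ()

padTo : ℕ → List ℕ → List ℕ
padTo L A = replicate (L ∸ length A) 0 ++ A

length-padTo : ∀ {L} A → length A ≤ L → length (padTo L A) ≡ L
length-padTo {L} A A≤L = begin
  length (replicate (L ∸ length A) 0 ++ A)         ≡⟨ length-++ (replicate (L ∸ length A) 0) ⟩
  length (replicate (L ∸ length A) 0) ℕ.+ length A ≡⟨ cong (ℕ._+ length A) (length-replicate (L ∸ length A)) ⟩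
  L ∸ length A ℕ.+ length A                        ≡⟨ ℕ.m∸n+n≡m A≤L ⟩
  L                                                ∎
  where open ≡-Reasoning

linked-zeros++ : ∀ z {A} → Linked _≤_ A → Linked _≤_ (replicate z 0 ++ A)
linked-zeros++ zero    linked = linked
linked-zeros++ (suc z) linked = 0∷ (linked-zeros++ z linked)
  where
  0∷ : ∀ {xs} → Linked _≤_ xs → Linked _≤_ (0 ∷ xs)
  0∷ []      = [-]
  0∷ [-]     = z≤n ∷ [-]
  0∷ (r ∷ l) = z≤n ∷ r ∷ l

≤-maxHeight : ∀ B → All (_≤ maxHeight B) B
≤-maxHeight []      = []
≤-maxHeight (b ∷ B) = ℕ.m≤m⊔n b (maxHeight B) ∷ All.map (ℕ.m≤n⇒m≤o⊔n b) (≤-maxHeight B)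

fileNumber-padTo : ∀ k m {L} B → IsFerrers B → fileNumber k m (padTo L (nonzeroCols B)) ≡ fileNumber k m B
fileNumber-padTo k m {L} B ferrers with z , eq ← ferrers-zeros++nonzeroCols B ferrers = begin
  fileNumber k m (padTo L (nonzeroCols B)) ≡⟨ fileNumber-zeros k m (L ∸ length (nonzeroCols B)) (nonzeroCols B) ⟩
  fileNumber k m (nonzeroCols B)           ≡⟨ sym (fileNumber-zeros k m z (nonzeroCols B)) ⟩
  fileNumber k m (replicate z 0 ++ nonzeroCols B) ≡⟨ cong (fileNumber k m) (sym eq) ⟩
  fileNumber k m B                         ∎
  where open ≡-Reasoning

rootProduct-padTo : ∀ m {L} x B → IsFerrers B → length (nonzeroCols B) ≤ L →
  rootProduct x (roots m 0 (padTo L (nonzeroCols B)))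
  ≡ ∑ (upTo (suc L)) (λ k → fileNumber k m B * fallingM x (L ∸ k) m)
rootProduct-padTo m {L} x B ferrers A≤L = begin
  rootProduct x (roots m 0 P)
    ≡⟨ sym (factorization m x P (linked-zeros++ (L ∸ length A) ferrersA) (≤-maxHeight P)) ⟩
  placementSum m (maxHeight P) (length P) x P
    ≡⟨ cong (λ n → placementSum m (maxHeight P) n x P) (length-padTo A A≤L) ⟩
  placementSum m (maxHeight P) L x P
    ≡⟨ placementSum≡∑fileNumber m x P (ℕ.≤-reflexive (length-padTo A A≤L)) ⟩
  ∑ (upTo (suc L)) (λ k → fileNumber k m P * fallingM x (L ∸ k) m)
    ≡⟨ Sum.fold-cong (upTo (suc L)) (λ k _ → cong (_* fallingM x (L ∸ k) m) (fileNumber-padTo k m B ferrers)) ⟩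
  ∑ (upTo (suc L)) (λ k → fileNumber k m B * fallingM x (L ∸ k) m) ∎
  where
  open ≡-Reasoning
  A = nonzeroCols B
  P = padTo L A
  ferrersA : IsFerrers A
  ferrersA = Linked.filter⁺ (λ c → ¬? (c ≟ 0)) ℕ.≤-trans ferrers

-- Unique factorization into linear factors

rootProduct-mid : ∀ x ys r zs → rootProduct x (ys ++ r ∷ zs) ≡ (x - r) * rootProduct x (ys ++ zs)
rootProduct-mid x []       r zs = refl
rootProduct-mid x (y ∷ ys) r zs =
  trans (cong ((x - y) *_) (rootProduct-mid x ys r zs)) (swapFront (x - y) (x - r) _)
  where
  swapFront : ∀ a b c → a * (b * c) ≡ b * (a * c)
  swapFront = solve-∀

rootProduct-root : ∀ r rs → rootProduct r (r ∷ rs) ≡ 0ℤ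
rootProduct-root r rs = trans (cong (_* rootProduct r rs) (ℤ.+-inverseʳ r)) (ℤ.*-zeroˡ (rootProduct r rs))

rootProduct≡0⇒∈ : ∀ x rs → rootProduct x rs ≡ 0ℤ → x ∈ rs
rootProduct≡0⇒∈ x (r ∷ rs) P≡0 with ℤ.i*j≡0⇒i≡0∨j≡0 (x - r) P≡0
... | inj₁ x-r≡0 = here (ℤ.i-j≡0⇒i≡j x r x-r≡0)
... | inj₂ rest≡0 = there (rootProduct≡0⇒∈ x rs rest≡0)

HasDividedDifferences : (ℤ → ℤ) → Set
HasDividedDifferences f = ∀ x y → ∃[ q ] f x - f y ≡ q * (x - y)

rootProduct-dividedDifferences : ∀ rs → HasDividedDifferences (λ x → rootProduct x rs)
rootProduct-dividedDifferences []       x y = 0ℤ , trans (ℤ.+-inverseʳ 1ℤ) (sym (ℤ.*-zeroˡ (x - y)))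
rootProduct-dividedDifferences (r ∷ rs) x y with rootProduct-dividedDifferences rs x y
... | q , eq = (x - r) * q + rootProduct y rs , (begin
  (x - r) * rootProduct x rs - (y - r) * rootProduct y rs
    ≡⟨ cong (λ t → (x - r) * t - (y - r) * rootProduct y rs) (expand eq) ⟩
  (x - r) * (q * (x - y) + rootProduct y rs) - (y - r) * rootProduct y rs
    ≡⟨ collect x y r q (rootProduct y rs) ⟩
  ((x - r) * q + rootProduct y rs) * (x - y) ∎)
  where
  open ≡-Reasoning
  expand : ∀ {a b c} → a - b ≡ c → a ≡ c + b
  expand {a} {b} refl = cancel a b
    where
    cancel : ∀ a b → a ≡ (a - b) + b
    cancel = solve-∀
  collect : ∀ x y r q p → (x - r) * (q * (x - y) + p) - (y - r) * p ≡ ((x - r) * q + p) * (x - y)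
  collect = solve-∀

-- f a is divisible by a - y for y arbitrarily far from a.
vanishes-everywhere : ∀ f a → HasDividedDifferences f → (∀ x → x ≢ a → f x ≡ 0ℤ) → f a ≡ 0ℤ
vanishes-everywhere f a dd vanish = ℤ.∣i∣≡0⇒i≡0 (≡*suc⇒≡0 ∣ q ∣ ∣fa∣≡∣q∣*n)
  where
  n = suc ∣ f a ∣
  y = a + + n
  q = proj₁ (dd a y)
  a-y≡-n : a - y ≡ - + n
  a-y≡-n = overshoot a (+ n)
    where
    overshoot : ∀ a n → a - (a + n) ≡ - n
    overshoot = solve-∀
  y≢a : y ≢ a
  y≢a y≡a with trans (sym a-y≡-n) (trans (cong (_-_ a) y≡a) (ℤ.+-inverseʳ a))
  ... | ()
  ∣fa∣≡∣q∣*n : ∣ f a ∣ ≡ ∣ q ∣ ℕ.* n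
  ∣fa∣≡∣q∣*n = begin
    ∣ f a ∣                 ≡⟨ cong ∣_∣ (sym (trans (cong (_-_ (f a)) (vanish y y≢a)) (ℤ.+-identityʳ (f a)))) ⟩
    ∣ f a - f y ∣           ≡⟨ cong ∣_∣ (proj₂ (dd a y)) ⟩
    ∣ q * (a - y) ∣         ≡⟨ ℤ.abs-* q (a - y) ⟩
    ∣ q ∣ ℕ.* ∣ a - y ∣     ≡⟨ cong (λ t → ∣ q ∣ ℕ.* ∣ t ∣) a-y≡-n ⟩
    ∣ q ∣ ℕ.* ∣ - + n ∣     ≡⟨ cong (∣ q ∣ ℕ.*_) (ℤ.∣-i∣≡∣i∣ (+ n)) ⟩
    ∣ q ∣ ℕ.* n             ∎
    where open ≡-Reasoning
  ≡*suc⇒≡0 : ∀ c {k} → k ≡ c ℕ.* suc k → k ≡ 0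
  ≡*suc⇒≡0 zero    eq = eq
  ≡*suc⇒≡0 (suc c) {k} eq = contradiction eq (ℕ.m≢1+m+n k)

dividedDifferences-- : ∀ {f g} → HasDividedDifferences f → HasDividedDifferences g →
  HasDividedDifferences (λ x → f x - g x)
dividedDifferences-- {f} {g} ddf ddg x y with ddf x y | ddg x y
... | q₁ , eq₁ | q₂ , eq₂ = q₁ - q₂ , (begin
  (f x - g x) - (f y - g y) ≡⟨ regroup (f x) (g x) (f y) (g y) ⟩
  (f x - f y) - (g x - g y) ≡⟨ cong₂ _-_ eq₁ eq₂ ⟩
  q₁ * (x - y) - q₂ * (x - y) ≡⟨ factor q₁ q₂ (x - y) ⟩
  (q₁ - q₂) * (x - y)       ∎)
  where
  open ≡-Reasoning
  regroup : ∀ a b c d → (a - b) - (c - d) ≡ (a - c) - (b - d)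
  regroup = solve-∀
  factor : ∀ a b c → a * c - b * c ≡ (a - b) * c
  factor = solve-∀

rootProduct-cancelˡ : ∀ r rs ss → (∀ x → (x - r) * rootProduct x rs ≡ (x - r) * rootProduct x ss) →
  ∀ x → rootProduct x rs ≡ rootProduct x ss
rootProduct-cancelˡ r rs ss eqs x = ℤ.i-j≡0⇒i≡j _ _ (difference≡0 x)
  where
  difference : ℤ → ℤ
  difference x = rootProduct x rs - rootProduct x ss
  differenceOff : ∀ x → x ≢ r → difference x ≡ 0ℤ
  differenceOff x x≢r =
    ℤ.i≡j⇒i-j≡0 (ℤ.*-cancelˡ-≡ (x - r) _ _ {{ℤ.≢-nonZero (x≢r ∘ ℤ.i-j≡0⇒i≡j x r)}} (eqs x))
  difference≡0 : ∀ x → difference x ≡ 0ℤ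
  difference≡0 x with x ℤ.≟ r
  ... | yes refl = vanishes-everywhere difference r
                     (dividedDifferences-- {λ x → rootProduct x rs} {λ x → rootProduct x ss}
                       (rootProduct-dividedDifferences rs) (rootProduct-dividedDifferences ss))
                     differenceOff
  ... | no x≢r   = differenceOff x x≢r

rootProduct-injective : ∀ rs ss → (∀ x → rootProduct x rs ≡ rootProduct x ss) → rs ↭ ss
rootProduct-injective [] []       _   = ↭-refl
rootProduct-injective [] (s ∷ ss) eqs with trans (eqs s) (rootProduct-root s ss)
... | ()
rootProduct-injective (r ∷ rs) ss eqs
  with ys , zs , refl ← ∈-∃++ (rootProduct≡0⇒∈ r ss (trans (sym (eqs r)) (rootProduct-root r rs))) =
  ↭-trans (↭-prep r (rootProduct-injective rs (ys ++ zs) (rootProduct-cancelˡ r rs (ys ++ zs) eqs′)))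
          (↭-sym (shift r ys zs))
  where
  eqs′ : ∀ x → (x - r) * rootProduct x rs ≡ (x - r) * rootProduct x (ys ++ zs)
  eqs′ x = trans (eqs x) (rootProduct-mid x ys r zs)

roots-padTo-↭ : ∀ m {L} B B′ → IsFerrers B → IsFerrers B′ → FileEquiv m B B′ →
  length (nonzeroCols B) ≤ L → length (nonzeroCols B′) ≤ L →
  roots m 0 (padTo L (nonzeroCols B)) ↭ roots m 0 (padTo L (nonzeroCols B′))
roots-padTo-↭ m {L} B B′ ferrers ferrers′ equiv A≤L A′≤L = rootProduct-injective _ _ λ x → begin
  rootProduct x (roots m 0 (padTo L (nonzeroCols B)))
    ≡⟨ rootProduct-padTo m x B ferrers A≤L ⟩
  ∑ (upTo (suc L)) (λ k → fileNumber k m B * fallingM x (L ∸ k) m)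
    ≡⟨ Sum.fold-cong (upTo (suc L)) (λ k _ → cong (_* fallingM x (L ∸ k) m) (equiv k)) ⟩
  ∑ (upTo (suc L)) (λ k → fileNumber k m B′ * fallingM x (L ∸ k) m)
    ≡⟨ sym (rootProduct-padTo m x B′ ferrers′ A′≤L) ⟩
  rootProduct x (roots m 0 (padTo L (nonzeroCols B′))) ∎
  where open ≡-Reasoning

-- Counting roots below T m

BoundedFrom : ℕ → ℕ → List ℕ → Set
BoundedFrom m j []       = ⊤
BoundedFrom m j (b ∷ bs) = b ≤ j ℕ.* m × BoundedFrom m (suc j) bs

Fits : ℕ → ℕ → List ℕ → Set
Fits N m A = length A ≤ N × BoundedFrom m (N ∸ length A) A

-- `boundedFrom` is private to Defs, so the shift of its starting column is done by generalising over it.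
fitsIn⇔fits : ∀ N m B → FitsIn N m B ⇔ Fits N m (nonzeroCols B)
fitsIn⇔fits N m B = mk⇔ (λ fits → proj₁ fits , to N B fits) (from N B)
  where
  ℓ : List ℕ → ℕ
  ℓ B = length (nonzeroCols B)
  to : ∀ N B → FitsIn N m B → BoundedFrom m (N ∸ ℓ B) (nonzeroCols B)
  to N       []          _ = tt
  to N       (zero ∷ B)  fits = to N B fits
  to (suc N) (suc b ∷ B) (s≤s ℓ≤N , b≤ , rest) with suc (N ∸ ℓ B) | rest | sym (ℕ.+-∸-assoc 1 ℓ≤N)
  ... | _ | rest′ | refl = b≤ , to (suc N) B (ℕ.m≤n⇒m≤1+n ℓ≤N , rest′)
  from : ∀ N B → Fits N m (nonzeroCols B) → FitsIn N m B
  from N       []          fits = fits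
  from N       (zero ∷ B)  fits = from N B fits
  from (suc N) (suc b ∷ B) (s≤s ℓ≤N , b≤ , rest) with suc (N ∸ ℓ B) | rest | sym (ℕ.+-∸-assoc 1 ℓ≤N)
  ... | _ | rest′ | refl = s≤s ℓ≤N , b≤ , proj₂ (from (suc N) B (ℕ.m≤n⇒m≤1+n ℓ≤N , rest′))

#below : ℤ → List ℤ → ℕ
#below t rs = length (filter (ℤ._<? t) rs)

#below-↭ : ∀ t {rs ss} → rs ↭ ss → #below t rs ≡ #below t ss
#below-↭ t rs↭ss = ↭-length (filter-↭ (ℤ._<? t) rs↭ss)

#below-++ : ∀ t rs ss → #below t (rs ++ ss) ≡ #below t rs ℕ.+ #below t ss
#below-++ t rs ss = trans (cong length (filter-++ (ℤ._<? t) rs ss)) (length-++ (filter (ℤ._<? t) rs))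

#below≡0⇔ : ∀ t rs → #below t rs ≡ 0 ⇔ All (λ r → ¬ r ℤ.< t) rs
#below≡0⇔ t rs = mk⇔
  (λ none → All.¬Any⇒All¬ rs λ some → ℕ.<-irrefl (sym none) (filter-some (ℤ._<? t) some))
  (λ all → cong length (filter-none (ℤ._<? t) all))

m-n<o⇔m<o+n : ∀ a b c → + a - + b ℤ.< + c ⇔ a ℕ.< c ℕ.+ b
m-n<o⇔m<o+n a b c = mk⇔
  (λ lt → ℤ.drop‿+<+ (subst₂ ℤ._<_ (minusPlus (+ a) (+ b)) (sym (ℤ.pos-+ c b)) (ℤ.+-monoˡ-< (+ b) lt)))
  (λ lt → subst (_ ℤ.<_) (plusMinus (+ c) (+ b))
                 (ℤ.+-monoˡ-< (- + b) (subst (+ a ℤ.<_) (ℤ.pos-+ c b) (ℤ.+<+ lt))))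
  where
  minusPlus : ∀ a b → a - b + b ≡ a
  minusPlus = solve-∀
  plusMinus : ∀ c b → c + b - b ≡ c
  plusMinus = solve-∀

#below-roots : ∀ m .{{_ : NonZero m}} {T} j X → j ℕ.+ length X ≤ T →
  #below (+ (T ℕ.* m)) (roots m j X) ≡ length X
#below-roots m         j []      _     = refl
#below-roots m {T = T} j (x ∷ X) bound = trans
  (cong length (filter-accept (ℤ._<? + (T ℕ.* m))
                              (Equivalence.from (m-n<o⇔m<o+n (j ℕ.* m) x (T ℕ.* m)) j*m<T*m+x)))
  (cong suc (#below-roots m (suc j) X (ℕ.≤-trans (ℕ.≤-reflexive (sym (ℕ.+-suc j (length X)))) bound)))
  where
  j*m<T*m+x : j ℕ.* m ℕ.< T ℕ.* m ℕ.+ x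
  j*m<T*m+x = ℕ.<-≤-trans (ℕ.*-monoˡ-< m (ℕ.<-≤-trans (ℕ.m<m+n j ℕ.z<s) bound)) (ℕ.m≤m+n (T ℕ.* m) x)

#below-roots-++ : ∀ m .{{_ : NonZero m}} {T} X Q → length X ≡ T →
  #below (+ (T ℕ.* m)) (roots m 0 (X ++ Q)) ≡ T ℕ.+ #below (+ (T ℕ.* m)) (roots m T Q)
#below-roots-++ m X Q refl = begin
  #below t (roots m 0 (X ++ Q))
    ≡⟨ cong (#below t) (roots-++ m 0 X Q) ⟩
  #below t (roots m 0 X ++ roots m (length X) Q)
    ≡⟨ #below-++ t (roots m 0 X) _ ⟩
  #below t (roots m 0 X) ℕ.+ #below t (roots m (length X) Q)
    ≡⟨ cong (ℕ._+ #below t (roots m (length X) Q)) (#below-roots m 0 X ℕ.≤-refl) ⟩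
  length X ℕ.+ #below t (roots m (length X) Q) ∎
  where
  open ≡-Reasoning
  t = + (length X ℕ.* m)

root≮⇔bounded : ∀ m T i b → (¬ (+ ((i ℕ.+ T) ℕ.* m) - + b ℤ.< + (T ℕ.* m))) ⇔ b ≤ i ℕ.* m
root≮⇔bounded m T i b = mk⇔ (λ ≮ → ℕ.≮⇒≥ (≮ ∘ from ∘ addT)) (λ b≤ lt → ℕ.<⇒≱ (cancelT (to lt)) b≤)
  where
  open Equivalence (m-n<o⇔m<o+n ((i ℕ.+ T) ℕ.* m) b (T ℕ.* m))
  split : (i ℕ.+ T) ℕ.* m ≡ i ℕ.* m ℕ.+ T ℕ.* m
  split = ℕ.*-distribʳ-+ m i T
  addT : i ℕ.* m ℕ.< b → (i ℕ.+ T) ℕ.* m ℕ.< T ℕ.* m ℕ.+ b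
  addT lt = subst₂ ℕ._<_ (sym split) (ℕ.+-comm b (T ℕ.* m)) (ℕ.+-monoˡ-< (T ℕ.* m) lt)
  cancelT : (i ℕ.+ T) ℕ.* m ℕ.< T ℕ.* m ℕ.+ b → i ℕ.* m ℕ.< b
  cancelT lt = ℕ.+-cancelʳ-< (T ℕ.* m) (i ℕ.* m) b (subst₂ ℕ._<_ split (ℕ.+-comm (T ℕ.* m) b) lt)

boundedFrom⇔roots≮ : ∀ m T i Q →
  BoundedFrom m i Q ⇔ All (λ r → ¬ r ℤ.< + (T ℕ.* m)) (roots m (i ℕ.+ T) Q)
boundedFrom⇔roots≮ m T i []      = mk⇔ (λ _ → []) (λ _ → tt)
boundedFrom⇔roots≮ m T i (b ∷ Q) = mk⇔
  (λ (b≤ , bounded) → Equivalence.from head b≤ ∷ Equivalence.to tail bounded)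
  (λ { (≮ ∷ ≮s) → Equivalence.to head ≮ , Equivalence.from tail ≮s })
  where
  head = root≮⇔bounded m T i b
  tail = boundedFrom⇔roots≮ m T (suc i) Q

boundedFrom-zeros++ : ∀ m j k A → BoundedFrom m j (replicate k 0 ++ A) ⇔ BoundedFrom m (j ℕ.+ k) A
boundedFrom-zeros++ m j zero    A =
  subst (λ i → BoundedFrom m j A ⇔ BoundedFrom m i A) (sym (ℕ.+-identityʳ j)) (mk⇔ id id)
boundedFrom-zeros++ m j (suc k) A = subst (λ i → BoundedFrom m j (replicate (suc k) 0 ++ A) ⇔ BoundedFrom m i A)
  (sym (ℕ.+-suc j k)) (⇔-trans (mk⇔ proj₂ (z≤n ,_)) (boundedFrom-zeros++ m (suc j) k A))

-- The roots at the first T positions all lie below T m, whatever the column heights.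
#below≡T⇔boundedFrom : ∀ m .{{_ : NonZero m}} {T} X Q → length X ≡ T →
  #below (+ (T ℕ.* m)) (roots m 0 (X ++ Q)) ≡ T ⇔ BoundedFrom m 0 Q
#below≡T⇔boundedFrom m {T} X Q |X|≡T = begin
  #below t (roots m 0 (X ++ Q)) ≡ T           ≈⟨ mk⇔ (trans (sym split)) (trans split) ⟩
  T ℕ.+ #below t (roots m T Q) ≡ T
    ≈⟨ mk⇔ (λ eq → ℕ.+-cancelˡ-≡ T _ 0 (trans eq (sym (ℕ.+-identityʳ T))))
           (λ eq → trans (cong (T ℕ.+_) eq) (ℕ.+-identityʳ T)) ⟩
  #below t (roots m T Q) ≡ 0                  ≈⟨ #below≡0⇔ t (roots m T Q) ⟩
  All (λ r → ¬ r ℤ.< t) (roots m (0 ℕ.+ T) Q) ≈⟨ ⇔-sym (boundedFrom⇔roots≮ m T 0 Q) ⟩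
  BoundedFrom m 0 Q                           ∎
  where
  open ⇔-Reasoning
  t = + (T ℕ.* m)
  split = #below-roots-++ m X Q |X|≡T

split-at : ∀ {k} (A : List ℕ) → k < length A → ∃[ Y ] ∃[ a ] ∃[ Z ] (A ≡ Y ++ a ∷ Z × length Y ≡ k)
split-at {zero}  (a ∷ A) _ = [] , a , A , refl , refl
split-at {suc k} (a ∷ A) (s≤s k<ℓ) with Y , b , Z , refl , refl ← split-at A k<ℓ = a ∷ Y , b , Z , refl , refl

replicate-+ : ∀ a b (x : ℕ) → replicate (a ℕ.+ b) x ≡ replicate a x ++ replicate b x
replicate-+ zero    b x = refl
replicate-+ (suc a) b x = cong (x ∷_) (replicate-+ a b x)

zeros++-split : ∀ {T p} (A : List ℕ) → T ≤ p → replicate p 0 ++ A ≡ replicate T 0 ++ (replicate (p ∸ T) 0 ++ A)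
zeros++-split {T} {p} A T≤p = begin
  replicate p 0 ++ A                          ≡⟨ cong (λ n → replicate n 0 ++ A) (sym (ℕ.m+[n∸m]≡n T≤p)) ⟩
  replicate (T ℕ.+ (p ∸ T)) 0 ++ A            ≡⟨ cong (_++ A) (replicate-+ T (p ∸ T) 0) ⟩
  (replicate T 0 ++ replicate (p ∸ T) 0) ++ A ≡⟨ ++-assoc (replicate T 0) (replicate (p ∸ T) 0) A ⟩
  replicate T 0 ++ (replicate (p ∸ T) 0 ++ A) ∎
  where open ≡-Reasoning

#below-zeros++⇔ : ∀ m .{{_ : NonZero m}} {T} p A → All (_≢ 0) A → T < p ℕ.+ length A →
  #below (+ (T ℕ.* m)) (roots m 0 (replicate p 0 ++ A)) ≡ T ⇔ (T ≤ p × BoundedFrom m (p ∸ T) A)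
#below-zeros++⇔ m {T} p A nonzero T<p+ℓ with T ℕ.≤? p
... | yes T≤p rewrite zeros++-split A T≤p = begin
  #below t (roots m 0 (replicate T 0 ++ Q)) ≡ T
    ≈⟨ #below≡T⇔boundedFrom m (replicate T 0) Q (length-replicate T) ⟩
  BoundedFrom m 0 Q
    ≈⟨ boundedFrom-zeros++ m 0 (p ∸ T) A ⟩
  BoundedFrom m (p ∸ T) A
    ≈⟨ mk⇔ (T≤p ,_) proj₂ ⟩
  (T ≤ p × BoundedFrom m (p ∸ T) A) ∎
  where
  open ⇔-Reasoning
  t = + (T ℕ.* m)
  Q = replicate (p ∸ T) 0 ++ A
... | no T≰p
  with split-at A (subst (T ∸ p <_) (ℕ.m+n∸m≡n p (length A)) (ℕ.∸-monoˡ-< T<p+ℓ (ℕ.<⇒≤ (ℕ.≰⇒> T≰p))))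
... | Y , a , Z , refl , |Y|≡T∸p rewrite sym (++-assoc (replicate p 0) Y (a ∷ Z)) = mk⇔
  (λ below → contradiction (ℕ.n≤0⇒n≡0 (proj₁ (Equivalence.to boundedTail below))) a≢0)
  (λ (T≤p , _) → contradiction T≤p T≰p)
  where
  a≢0 : a ≢ 0
  a≢0 = All.head (All.++⁻ʳ Y nonzero)
  |X|≡T : length (replicate p 0 ++ Y) ≡ T
  |X|≡T = begin
    length (replicate p 0 ++ Y)         ≡⟨ length-++ (replicate p 0) ⟩
    length (replicate p 0) ℕ.+ length Y ≡⟨ cong₂ ℕ._+_ (length-replicate p) |Y|≡T∸p ⟩
    p ℕ.+ (T ∸ p)                       ≡⟨ ℕ.m+[n∸m]≡n (ℕ.<⇒≤ (ℕ.≰⇒> T≰p)) ⟩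
    T                                   ∎
    where open ≡-Reasoning
  boundedTail = #below≡T⇔boundedFrom m (replicate p 0 ++ Y) (a ∷ Z) |X|≡T

#below-padTo⇔fits : ∀ m .{{_ : NonZero m}} T N A → All (_≢ 0) A → length A ≤ T ℕ.+ suc N →
  #below (+ (T ℕ.* m)) (roots m 0 (padTo (T ℕ.+ suc N) A)) ≡ T ⇔ Fits (suc N) m A
#below-padTo⇔fits m T N A nonzero A≤L =
  ⇔-trans (#below-zeros++⇔ m p A nonzero T<p+ℓ) (mk⇔
    (λ (T≤p , bounded) → let ℓ≤n = ℓ≤n⇐T≤p T≤p in ℓ≤n , subst (λ j → BoundedFrom m j A) (p∸T≡n∸ℓ ℓ≤n) bounded)
    (λ (ℓ≤n , bounded) → T≤p⇐ℓ≤n ℓ≤n , subst (λ j → BoundedFrom m j A) (sym (p∸T≡n∸ℓ ℓ≤n)) bounded))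
  where
  n = suc N
  ℓ = length A
  p = T ℕ.+ n ∸ ℓ
  p+ℓ≡T+n : p ℕ.+ ℓ ≡ T ℕ.+ n
  p+ℓ≡T+n = ℕ.m∸n+n≡m A≤L
  T<p+ℓ : T < p ℕ.+ ℓ
  T<p+ℓ = subst (T <_) (sym p+ℓ≡T+n) (ℕ.m<m+n T ℕ.z<s)
  ℓ≤n⇐T≤p : T ≤ p → ℓ ≤ n
  ℓ≤n⇐T≤p T≤p = ℕ.+-cancelˡ-≤ T ℓ n (subst (T ℕ.+ ℓ ≤_) p+ℓ≡T+n (ℕ.+-monoˡ-≤ ℓ T≤p))
  p≡T+[n∸ℓ] : ℓ ≤ n → p ≡ T ℕ.+ (n ∸ ℓ)
  p≡T+[n∸ℓ] = ℕ.+-∸-assoc T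
  T≤p⇐ℓ≤n : ℓ ≤ n → T ≤ p
  T≤p⇐ℓ≤n ℓ≤n = subst (T ≤_) (sym (p≡T+[n∸ℓ] ℓ≤n)) (ℕ.m≤m+n T (n ∸ ℓ))
  p∸T≡n∸ℓ : ℓ ≤ n → p ∸ T ≡ n ∸ ℓ
  p∸T≡n∸ℓ ℓ≤n = trans (cong (_∸ T) (p≡T+[n∸ℓ] ℓ≤n)) (ℕ.m+n∸m≡n T (n ∸ ℓ))

boundedFrom-suc : ∀ m {j} A → BoundedFrom m j A → BoundedFrom m (suc j) A
boundedFrom-suc m []      _               = tt
boundedFrom-suc m {j} (b ∷ A) (b≤ , bounded) =
  ℕ.≤-trans b≤ (ℕ.*-monoˡ-≤ m (ℕ.n≤1+n j)) , boundedFrom-suc m A bounded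

fits-suc : ∀ {N m} A → Fits N m A → Fits (suc N) m A
fits-suc {N} {m} A (ℓ≤N , bounded) =
  ℕ.m≤n⇒m≤1+n ℓ≤N ,
  subst (λ j → BoundedFrom m j A) (sym (ℕ.+-∸-assoc 1 ℓ≤N)) (boundedFrom-suc m A bounded)

fits-1⇒fits-0 : ∀ {m} A → All (_≢ 0) A → Fits 1 m A → Fits 0 m A
fits-1⇒fits-0 []          _         _             = z≤n , tt
fits-1⇒fits-0 (a ∷ [])    (a≢0 ∷ _) (_ , a≤0 , _) = contradiction (ℕ.n≤0⇒n≡0 a≤0) a≢0
fits-1⇒fits-0 (_ ∷ _ ∷ _) _         (s≤s () , _)

fits-preserved : ∀ m .{{_ : NonZero m}} N B B′ → IsFerrers B → IsFerrers B′ → FileEquiv m B B′ →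
  Fits (suc N) m (nonzeroCols B) → Fits (suc N) m (nonzeroCols B′)
fits-preserved m N B B′ ferrers ferrers′ equiv fits =
  Equivalence.to (#below-padTo⇔fits m T N A′ (All.all-filter _ B′) A′≤L) (begin
    #below t (roots m 0 (padTo L A′))
      ≡⟨ #below-↭ t (↭-sym (roots-padTo-↭ m B B′ ferrers ferrers′ equiv A≤L A′≤L)) ⟩
    #below t (roots m 0 (padTo L A))
      ≡⟨ Equivalence.from (#below-padTo⇔fits m T N A (All.all-filter _ B) A≤L) fits ⟩
    T ∎)
  where
  open ≡-Reasoning
  A = nonzeroCols B
  A′ = nonzeroCols B′
  T = length A ℕ.+ length A′
  L = T ℕ.+ suc N
  t = + (T ℕ.* m)
  A≤L : length A ≤ L
  A≤L = ℕ.≤-trans (ℕ.m≤m+n (length A) (length A′)) (ℕ.m≤m+n T (suc N))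
  A′≤L : length A′ ≤ L
  A′≤L = ℕ.≤-trans (ℕ.m≤n+m (length A′) (length A)) (ℕ.m≤m+n T (suc N))

lemma8p3 : (m : ℕ) → .{{_ : NonZero m}} → (N : ℕ) → (B B' : List ℕ) →
           IsFerrers B → IsFerrers B' →
           FitsIn N m B → FileEquiv m B B' → FitsIn N m B'
lemma8p3 m N B B′ ferrers ferrers′ fits equiv =
  Equivalence.from (fitsIn⇔fits N m B′) (transfer N (Equivalence.to (fitsIn⇔fits N m B) fits))
  where
  transfer : ∀ N → Fits N m (nonzeroCols B) → Fits N m (nonzeroCols B′)
  -- Δ_{0,m} is reached through Δ_{1,m}: counting roots needs a column at position T.
  transfer zero    =
    fits-1⇒fits-0 _ (All.all-filter _ B′) ∘ fits-preserved m 0 B B′ ferrers ferrers′ equiv ∘ fits-suc _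
  transfer (suc N) = fits-preserved m N B B′ ferrers ferrers′ equiv
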